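{- Let $D$ be a connected contrafunctional digraph with $h(D)=1$. Then $\gamma(D)=\rho(D)$.
   Context: A digraph is contrafunctional if every vertex has in-degree exactly one; a connected contrafunctional digraph contains exactly one directed cycle $C$. Its height is $h(D)=\max\{d_D(v,V(C)) : v\in V(D)\}$, where $d_D$ denotes directed distance. For a vertex $v$, $N^+[v]=\{v\}\cup\{u:(v,u)\text{ is an arc}\}$. A set $S$ is dominating if every vertex not in $S$ has an in-neighbor in $S$; $\gamma(D)$ is the minimum size of a dominating set. A set $B$ is a packing if $|N^+[v]\cap B|\le 1$ for every vertex $v$; $\rho(D)$ is the maximum size of a packing. -}

module Defs where

open import Data.Nat using (ℕ; zero; suc; _≤_; _<_)
open import Data.Fin using (Fin)
open import Data.Fin.Subset using (Subset; _∈_; _∉_; ∣_∣)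
open import Data.Product using (Σ; ∃; ∃-syntax; _×_; _,_; ∃!)
open import Data.Sum using (_⊎_)
open import Relation.Binary.PropositionalEquality using (_≡_)
open import Relation.Nullary using (¬_)

-- A (simple, loops allowed) digraph on the vertex set Fin n:
-- Arc u v means there is an arc (u , v).
record Digraph (n : ℕ) : Set₁ where
  field
    Arc : Fin n → Fin n → Set

module _ {n : ℕ} (D : Digraph n) where
  open Digraph D

  Contrafunctional : Set
  Contrafunctional = ∀ v → ∃! _≡_ (λ u → Arc u v)

  -- connected = weakly connected (connected underlying graph)
  data UWalk : Fin n → Fin n → Set where
    here  : ∀ {v} → UWalk v v
    fwd   : ∀ {u w v} → Arc u w → UWalk w v → UWalk u v
    bwd   : ∀ {u w v} → Arc w u → UWalk w v → UWalk u v

  Connected : Set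
  Connected = ∀ u v → UWalk u v

  data Walk : ℕ → Fin n → Fin n → Set where
    here : ∀ {v} → Walk zero v v
    step : ∀ {k u w v} → Arc u w → Walk k w v → Walk (suc k) u v

  OnCycle : Fin n → Set
  OnCycle v = ∃[ k ] Walk (suc k) v v

  -- d_D(V(C), v) ≤ k : some cycle vertex reaches v by a directed walk
  -- of length at most k
  WithinDist : ℕ → Fin n → Set
  WithinDist k v = ∃[ c ] OnCycle c × ∃[ j ] (j ≤ k × Walk j c v)

  -- h(D) = k : max over v of the distance from the cycle to v is k
  HeightIs : ℕ → Set
  HeightIs k = (∀ v → WithinDist k v)
             × (∃[ v ] (∀ j → j < k → ¬ WithinDist j v))

  Dominating : Subset n → Set
  Dominating S = ∀ v → v ∉ S → ∃[ u ] (u ∈ S × Arc u v)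

  InClosedOut : Fin n → Fin n → Set
  InClosedOut v x = v ≡ x ⊎ Arc v x

  Packing : Subset n → Set
  Packing B = ∀ v x y → InClosedOut v x → InClosedOut v y
              → x ∈ B → y ∈ B → x ≡ y

  DominationNumberIs : ℕ → Set
  DominationNumberIs k = (∃[ S ] (Dominating S × ∣ S ∣ ≡ k))
                       × (∀ S → Dominating S → k ≤ ∣ S ∣)

  PackingNumberIs : ℕ → Set
  PackingNumberIs k = (∃[ B ] (Packing B × ∣ B ∣ ≡ k))
                    × (∀ B → Packing B → ∣ B ∣ ≤ k)

-- Write p v for the unique in-neighbour of v. Height 1 means that every vertex
-- with a child lies on the cycle C, so all other vertices are leaves hanging off C;
-- call a vertex with a leaf child a support. By connectivity a support lies behind
-- every vertex, so d v, the number of p-steps from v back to the nearest support,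
-- is defined. The vertices with even d dominate, since a vertex with odd d has a
-- parent with even d; one chosen leaf per support together with the non-supports
-- with even d form a packing. Sending each support to its chosen leaf and every
-- other vertex to itself injects the dominating set into the packing, and ρ ≤ γ
-- holds in every digraph, so γ = ρ.

module Submission where

open import Data.Bool using (Bool; true; not)
import Data.Bool as Bool
open import Data.Bool.Properties using (not-¬; ¬-not; not-injective)
open import Data.Empty using (⊥)
open import Data.Fin using (Fin; zero; suc; _≟_)
open import Data.Fin.Properties using (any?)
open import Data.Fin.Subset using (Subset; _∈_; _∉_; ∣_∣; _-_; _⊆_; _⊂_; inside; outside; ⁅_⁆)
open import Data.Fin.Subset.Induction using (Acc; acc; ⊂-wellFounded)
open import Data.Fin.Subset.Properties
  using (_∈?_; p─⊥≡p; p─q⊆p; x∈p∧x≢y⇒x∈p-y; x∈p⇒p-x⊂p; nonempty?; Empty-unique; ∣⊥∣≡0)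
open import Data.Nat using (ℕ; zero; suc; _+_; _*_; _≤_; z≤n; s≤s)
open import Data.Nat.Properties
  using (≤-reflexive; ≤-trans; ≤-antisym; n≤0⇒n≡0; +-comm; *-comm; *-suc; module ≤-Reasoning)
open import Data.Product using (∃-syntax; ∃₂; _×_; _,_; proj₁; proj₂)
open import Data.Sum using (_⊎_; inj₁; inj₂)
open import Data.Vec using (_∷_; here; there; tabulate)
open import Data.Vec.Properties using (lookup∘tabulate; lookup⇒[]=; []=⇒lookup)
open import Function using (_∘_)
open import Relation.Binary.PropositionalEquality
open import Relation.Nullary using (¬_; yes; no; contradiction)
open import Relation.Nullary.Decidable using (does; dec-true; ¬?; _×-dec_; _⊎-dec_)
open import Relation.Unary using (Decidable)

open import Defs

x∉p-x : ∀ {n} {x : Fin n} {p : Subset n} → x ∉ p - x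
x∉p-x {x = zero}  {_ ∷ p} ()
x∉p-x {x = suc x} {_ ∷ p} (there x∈p-x) = x∉p-x x∈p-x

x∈p⇒∣p∣≡1+∣p-x∣ : ∀ {n} {x : Fin n} {p : Subset n} → x ∈ p → ∣ p ∣ ≡ suc ∣ p - x ∣
x∈p⇒∣p∣≡1+∣p-x∣ {x = zero}  {inside ∷ p}  here      = cong (suc ∘ ∣_∣) (sym (p─⊥≡p p))
x∈p⇒∣p∣≡1+∣p-x∣ {x = suc x} {inside ∷ p}  (there m) = cong suc (x∈p⇒∣p∣≡1+∣p-x∣ m)
x∈p⇒∣p∣≡1+∣p-x∣ {x = suc x} {outside ∷ p} (there m) = x∈p⇒∣p∣≡1+∣p-x∣ m

injective⇒∣p∣≤∣q∣ : ∀ {m n} {p : Subset m} {q : Subset n} (f : Fin m → Fin n)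
  → (∀ {x} → x ∈ p → f x ∈ q)
  → (∀ {x y} → x ∈ p → y ∈ p → f x ≡ f y → x ≡ y)
  → ∣ p ∣ ≤ ∣ q ∣
injective⇒∣p∣≤∣q∣ {m} {p = p} f = go (⊂-wellFounded p)
  where
  go : ∀ {p q} → Acc _⊂_ p → (∀ {x} → x ∈ p → f x ∈ q)
     → (∀ {x y} → x ∈ p → y ∈ p → f x ≡ f y → x ≡ y) → ∣ p ∣ ≤ ∣ q ∣
  go {p} {q} (acc rec) into inj with nonempty? p
  ... | no p-empty = ≤-trans (≤-reflexive (trans (cong ∣_∣ (Empty-unique p-empty)) (∣⊥∣≡0 m))) z≤n
  ... | yes (x , x∈p) = begin
    ∣ p ∣          ≡⟨ x∈p⇒∣p∣≡1+∣p-x∣ x∈p ⟩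
    suc ∣ p - x ∣  ≤⟨ s≤s (go (rec (x∈p⇒p-x⊂p x∈p)) into′ inj′) ⟩
    suc ∣ q - f x ∣ ≡⟨ sym (x∈p⇒∣p∣≡1+∣p-x∣ (into x∈p)) ⟩
    ∣ q ∣          ∎
    where
    open ≤-Reasoning
    p-x⊆p : p - x ⊆ p
    p-x⊆p = p─q⊆p p ⁅ x ⁆
    into′ : ∀ {y} → y ∈ p - x → f y ∈ q - f x
    into′ y∈p-x = x∈p∧x≢y⇒x∈p-y (into (p-x⊆p y∈p-x))
      λ fy≡fx → x∉p-x (subst (_∈ p - x) (inj (p-x⊆p y∈p-x) x∈p fy≡fx) y∈p-x)
    inj′ : ∀ {y z} → y ∈ p - x → z ∈ p - x → f y ≡ f z → y ≡ z
    inj′ y∈ z∈ = inj (p-x⊆p y∈) (p-x⊆p z∈)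

fromDec : ∀ {n} {P : Fin n → Set} → Decidable P → Subset n
fromDec P? = tabulate (does ∘ P?)

∈-fromDec⁺ : ∀ {n} {P : Fin n → Set} (P? : Decidable P) {x} → P x → x ∈ fromDec P?
∈-fromDec⁺ P? {x} px = lookup⇒[]= x _ (trans (lookup∘tabulate _ x) (dec-true (P? x) px))

∈-fromDec⁻ : ∀ {n} {P : Fin n → Set} (P? : Decidable P) {x} → x ∈ fromDec P? → P x
∈-fromDec⁻ P? {x} x∈ with P? x | trans (sym (lookup∘tabulate (does ∘ P?) x)) ([]=⇒lookup x∈)
... | yes px | _ = px
... | no _   | ()

least : ∀ {P : ℕ → Set} → Decidable P → ∀ N → P N → ∃[ d ] (P d × (∀ {t} → P t → d ≤ t))
least P? zero    p0 = 0 , p0 , λ _ → z≤n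
least P? (suc N) pN with P? 0
... | yes p0 = 0 , p0 , λ _ → z≤n
... | no ¬p0 with least (P? ∘ suc) N pN
...   | d , pd , minimal = suc d , pd , λ { {zero} p0 → contradiction p0 ¬p0 ; {suc t} pt → s≤s (minimal pt) }

infixr 8 _^_
_^_ : ∀ {A : Set} → (A → A) → ℕ → A → A
(f ^ zero) x = x
(f ^ suc k) x = f ((f ^ k) x)

Periodic : ∀ {A : Set} → (A → A) → A → Set
Periodic f x = ∃[ L ] (f ^ suc L) x ≡ x

module _ {A : Set} (f : A → A) where

  ^-+ : ∀ a b x → (f ^ (a + b)) x ≡ (f ^ a) ((f ^ b) x)
  ^-+ zero    b x = refl
  ^-+ (suc a) b x = cong f (^-+ a b x)

  ^-comm : ∀ k x → (f ^ k) (f x) ≡ f ((f ^ k) x)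
  ^-comm zero    x = refl
  ^-comm (suc k) x = cong f (^-comm k x)

  periodic-* : ∀ L {x} → (f ^ suc L) x ≡ x → ∀ m → (f ^ (m * suc L)) x ≡ x
  periodic-* L e zero = refl
  periodic-* L {x} e (suc m) = trans (^-+ (suc L) (m * suc L) x)
    (trans (cong (f ^ suc L) (periodic-* L e m)) e)

  periodic-f : ∀ {x} → Periodic f x → Periodic f (f x)
  periodic-f {x} (L , e) = L , trans (^-comm (suc L) x) (cong f e)

  -- Both points are fixed by f ^ N for N = (1 + a)(1 + b), and f ^ N = f ^ (N - 1) ∘ f.
  periodic-injective : ∀ {x y} → Periodic f x → Periodic f y → f x ≡ f y → x ≡ y
  periodic-injective {x} {y} (a , ex) (b , ey) fx≡fy = begin
    x             ≡⟨ sym (trans (^-comm K x) x-fixed) ⟩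
    (f ^ K) (f x) ≡⟨ cong (f ^ K) fx≡fy ⟩
    (f ^ K) (f y) ≡⟨ trans (^-comm K y) (periodic-* b ey (suc a)) ⟩
    y             ∎
    where
    open ≡-Reasoning
    K = b + a * suc b
    x-fixed : (f ^ suc K) x ≡ x
    x-fixed = subst (λ N → (f ^ N) x ≡ x) (*-comm (suc b) (suc a)) (periodic-* a ex (suc b))

  periodic-returns : ∀ {x} → Periodic f x → ∀ j → ∃[ t ] (f ^ t) ((f ^ j) x) ≡ x
  periodic-returns {x} (L , e) j = j * L , (begin
    (f ^ (j * L)) ((f ^ j) x) ≡⟨ sym (^-+ (j * L) j x) ⟩
    (f ^ (j * L + j)) x       ≡⟨ cong (λ t → (f ^ t) x) (trans (+-comm (j * L) j) (sym (*-suc j L))) ⟩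
    (f ^ (j * suc L)) x       ≡⟨ periodic-* L e j ⟩
    x                         ∎)
    where open ≡-Reasoning

module FirstHit {A : Set} (f : A → A) {P : A → Set} (P? : Decidable P)
                (eventually : ∀ x → ∃[ t ] P ((f ^ t) x)) where

  private
    first : ∀ x → ∃[ d ] (P ((f ^ d) x) × (∀ {t} → P ((f ^ t) x) → d ≤ t))
    first x = least (λ t → P? ((f ^ t) x)) (proj₁ (eventually x)) (proj₂ (eventually x))

  dist : A → ℕ
  dist x = proj₁ (first x)

  dist-hit : ∀ x → P ((f ^ dist x) x)
  dist-hit x = proj₁ (proj₂ (first x))

  dist-minimal : ∀ x {t} → P ((f ^ t) x) → dist x ≤ t
  dist-minimal x = proj₂ (proj₂ (first x))

  P⇒dist≡0 : ∀ {x} → P x → dist x ≡ 0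
  P⇒dist≡0 {x} px = n≤0⇒n≡0 (dist-minimal x px)

  ¬P⇒dist≡1+dist∘f : ∀ {x} → ¬ P x → dist x ≡ suc (dist (f x))
  ¬P⇒dist≡1+dist∘f {x} ¬px = ≤-antisym upper lower
    where
    upper : dist x ≤ suc (dist (f x))
    upper = dist-minimal x (subst P (^-comm f (dist (f x)) x) (dist-hit (f x)))
    lower : suc (dist (f x)) ≤ dist x
    lower with dist x | dist-hit x
    ... | zero  | px  = contradiction px ¬px
    ... | suc d | pfx = s≤s (dist-minimal (f x) (subst P (sym (^-comm f d x)) pfx))

even : ℕ → Bool
even zero    = true
even (suc k) = not (even k)

Even : ℕ → Set
Even k = even k ≡ true

Even? : Decidable Even
Even? k = even k Bool.≟ true

Even-suc⇒¬Even : ∀ k → Even (suc k) → ¬ Even k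
Even-suc⇒¬Even _ e-suc e = not-¬ (sym e) (sym e-suc)

¬Even-suc⇒Even : ∀ k → ¬ Even (suc k) → Even k
¬Even-suc⇒Even _ ¬e-suc = not-injective (¬-not ¬e-suc)

∣packing∣≤∣dominating∣ : ∀ {n} (D : Digraph n) {B S : Subset n}
  → Packing D B → Dominating D S → ∣ B ∣ ≤ ∣ S ∣
∣packing∣≤∣dominating∣ {n} D {B} {S} packing dominating =
  injective⇒∣p∣≤∣q∣ dominator (λ {v} _ → proj₁ (proj₂ (covered v)))
    λ {x} {y} x∈B y∈B same → packing (dominator x) x y (covers x)
      (subst (λ u → InClosedOut D u y) (sym same) (covers y)) x∈B y∈B
  where
  covered : ∀ v → ∃[ u ] (u ∈ S × InClosedOut D u v)
  covered v with v ∈? S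
  ... | yes v∈S = v , v∈S , inj₁ refl
  ... | no  v∉S with dominating v v∉S
  ...   | u , u∈S , arc = u , u∈S , inj₂ arc

  dominator : Fin n → Fin n
  dominator v = proj₁ (covered v)

  covers : ∀ v → InClosedOut D (dominator v) v
  covers v = proj₂ (proj₂ (covered v))

dominating≤packing⇒γ≡ρ : ∀ {n} (D : Digraph n) {S B : Subset n}
  → Dominating D S → Packing D B → ∣ S ∣ ≤ ∣ B ∣
  → ∃[ k ] (DominationNumberIs D k × PackingNumberIs D k)
dominating≤packing⇒γ≡ρ D {S} {B} dom pack S≤B =
  ∣ B ∣ , ((S , dom , ≤-antisym S≤B (∣packing∣≤∣dominating∣ D pack dom))
          , λ S′ dom′ → ∣packing∣≤∣dominating∣ D pack dom′)
        , ((B , pack , refl)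
          , λ B′ pack′ → ≤-trans (∣packing∣≤∣dominating∣ D pack′ dom) S≤B)

module ParentFunction {n : ℕ} (D : Digraph n) (cf : Contrafunctional D) where
  open Digraph D

  parent : Fin n → Fin n
  parent v = proj₁ (cf v)

  parent-arc : ∀ v → Arc (parent v) v
  parent-arc v = proj₁ (proj₂ (cf v))

  arc⇒parent : ∀ {u v} → Arc u v → parent v ≡ u
  arc⇒parent {v = v} = proj₂ (proj₂ (cf v))

  walk⇒parent^ : ∀ {k u v} → Walk D k u v → (parent ^ k) v ≡ u
  walk⇒parent^ here         = refl
  walk⇒parent^ (step a w) = trans (cong parent (walk⇒parent^ w)) (arc⇒parent a)

  parent^-walk : ∀ k v → Walk D k ((parent ^ k) v) v
  parent^-walk zero    v = here
  parent^-walk (suc k) v = step (parent-arc ((parent ^ k) v)) (parent^-walk k v)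

  onCycle⇒periodic : ∀ {v} → OnCycle D v → Periodic parent v
  onCycle⇒periodic (k , w) = k , walk⇒parent^ w

  periodic⇒onCycle : ∀ {v} → Periodic parent v → OnCycle D v
  periodic⇒onCycle {v} (L , e) = L , subst (λ u → Walk D (suc L) u v) e (parent^-walk (suc L) v)

  uwalk⇒meet : ∀ {u v} → UWalk D u v → ∃₂ λ i j → (parent ^ i) u ≡ (parent ^ j) v
  uwalk⇒meet here = 0 , 0 , refl
  uwalk⇒meet {u} (fwd {w = w} a walk) with uwalk⇒meet walk
  ... | i , j , meet = i , suc j ,
    trans (cong (parent ^ i) (sym (arc⇒parent a))) (trans (^-comm parent i w) (cong parent meet))
  uwalk⇒meet {u} (bwd a walk) with uwalk⇒meet walk
  ... | i , j , meet = suc i , j ,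
    trans (sym (^-comm parent i u)) (trans (cong (parent ^ i) (arc⇒parent a)) meet)

module HeightOne {n : ℕ} (D : Digraph n) (cf : Contrafunctional D)
                 (connected : Connected D) (height : HeightIs D 1) where
  open ParentFunction D cf

  HasChild : Fin n → Set
  HasChild v = ∃[ w ] parent w ≡ v

  hasChild? : Decidable HasChild
  hasChild? v = any? (λ w → parent w ≟ v)

  Leaf : Fin n → Set
  Leaf v = ¬ HasChild v

  Support : Fin n → Set
  Support v = ∃[ l ] (Leaf l × parent l ≡ v)

  support? : Decidable Support
  support? v = any? (λ l → ¬? (hasChild? l) ×-dec (parent l ≟ v))

  parent-periodic : ∀ w → Periodic parent (parent w)
  parent-periodic w with proj₁ height w
  ... | _ , onCycle , 0 , _ , here       = periodic-f parent (onCycle⇒periodic onCycle)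
  ... | _ , onCycle , 1 , _ , step a here =
    subst (Periodic parent) (sym (arc⇒parent a)) (onCycle⇒periodic onCycle)
  ... | _ , _ , suc (suc _) , s≤s () , _

  hasChild⇒periodic : ∀ {v} → HasChild v → Periodic parent v
  hasChild⇒periodic (w , refl) = parent-periodic w

  leaf-exists : ∃[ l ] Leaf l
  leaf-exists with proj₂ height
  ... | l , far = l , λ l-hasChild → far 0 (s≤s z≤n)
    (l , periodic⇒onCycle (hasChild⇒periodic l-hasChild) , 0 , z≤n , here)

  support-ahead : ∀ v → ∃[ t ] Support ((parent ^ t) v)
  support-ahead v with leaf-exists
  ... | l , leaf with uwalk⇒meet (connected v (parent l))
  ...   | i , j , meet with periodic-returns parent (parent-periodic l) j
  ...     | t , back = t + i , subst Support (sym reaches) (l , leaf , refl)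
    where
    reaches : (parent ^ (t + i)) v ≡ parent l
    reaches = trans (^-+ parent t i v) (trans (cong (parent ^ t) meet) back)

  open FirstHit parent support? support-ahead

  EvenDist : Fin n → Set
  EvenDist v = Even (dist v)

  evenDist? : Decidable EvenDist
  evenDist? v = Even? (dist v)

  EvenGap : Fin n → Set
  EvenGap v = ¬ Support v × EvenDist v

  evenGap? : Decidable EvenGap
  evenGap? v = ¬? (support? v) ×-dec evenDist? v

  leafOrSelf : Fin n → Fin n
  leafOrSelf v with support? v
  ... | yes (l , _) = l
  ... | no _        = v

  leafOrSelf-support : ∀ {v} → Support v → Leaf (leafOrSelf v) × parent (leafOrSelf v) ≡ v
  leafOrSelf-support {v} sv with support? v
  ... | yes (_ , leaf , child) = leaf , child
  ... | no ¬sv                 = contradiction sv ¬sv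

  leafOrSelf-other : ∀ {v} → ¬ Support v → leafOrSelf v ≡ v
  leafOrSelf-other {v} ¬sv with support? v
  ... | yes sv = contradiction sv ¬sv
  ... | no _   = refl

  Designated : Fin n → Set
  Designated l = Leaf l × leafOrSelf (parent l) ≡ l

  designated? : Decidable Designated
  designated? l = ¬? (hasChild? l) ×-dec (leafOrSelf (parent l) ≟ l)

  odd-below-support : ∀ {v} → Support (parent v) → ¬ Support v → ¬ EvenDist v
  odd-below-support s ¬sv evenDist =
    Even-suc⇒¬Even 0 (subst Even (trans (¬P⇒dist≡1+dist∘f ¬sv) (cong suc (P⇒dist≡0 s))) evenDist) refl

  evenGap⇒hasChild : ∀ {v} → EvenGap v → HasChild v
  evenGap⇒hasChild {v} (¬sv , evenDist) with hasChild? v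
  ... | yes hasChild = hasChild
  ... | no leaf      = contradiction evenDist (odd-below-support (v , leaf , refl) ¬sv)

  InPacking : Fin n → Set
  InPacking v = Designated v ⊎ EvenGap v

  inPacking? : Decidable InPacking
  inPacking? v = designated? v ⊎-dec evenGap? v

  dominatingSet packingSet : Subset n
  dominatingSet = fromDec evenDist?
  packingSet    = fromDec inPacking?

  evenDist-dominating : Dominating D dominatingSet
  evenDist-dominating v v∉S = parent v , ∈-fromDec⁺ evenDist? parent-even , parent-arc v
    where
    ¬evenDist : ¬ EvenDist v
    ¬evenDist = v∉S ∘ ∈-fromDec⁺ evenDist?
    ¬support : ¬ Support v
    ¬support s = ¬evenDist (cong even (P⇒dist≡0 s))
    parent-even : EvenDist (parent v)
    parent-even = ¬Even-suc⇒Even (dist (parent v)) (subst (¬_ ∘ Even) (¬P⇒dist≡1+dist∘f ¬support) ¬evenDist)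

  no-parent-child : ∀ {x y} → parent y ≡ x → InPacking x → InPacking y → ⊥
  no-parent-child {y = y} child (inj₁ (leaf , _)) _ = leaf (y , child)
  no-parent-child {y = y} child (inj₂ (¬sx , _)) (inj₁ (leaf , _)) = ¬sx (y , leaf , child)
  no-parent-child child (inj₂ (_ , evenDist-x)) (inj₂ (¬sy , evenDist-y)) =
    Even-suc⇒¬Even (dist _) (subst Even (trans (¬P⇒dist≡1+dist∘f ¬sy) (cong (suc ∘ dist) child)) evenDist-y) evenDist-x

  siblings-equal : ∀ {x y} → parent x ≡ parent y → InPacking x → InPacking y → x ≡ y
  siblings-equal same (inj₁ (_ , pick-x)) (inj₁ (_ , pick-y)) =
    trans (sym pick-x) (trans (cong leafOrSelf same) pick-y)
  siblings-equal {x} same (inj₁ (leaf , _)) (inj₂ (¬sy , evenDist-y)) =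
    contradiction evenDist-y (odd-below-support (x , leaf , same) ¬sy)
  siblings-equal {y = y} same (inj₂ (¬sx , evenDist-x)) (inj₁ (leaf , _)) =
    contradiction evenDist-x (odd-below-support (y , leaf , sym same) ¬sx)
  siblings-equal same (inj₂ gx) (inj₂ gy) =
    periodic-injective parent (hasChild⇒periodic (evenGap⇒hasChild gx))
      (hasChild⇒periodic (evenGap⇒hasChild gy)) same

  designated∪evenGap-packing : Packing D packingSet
  designated∪evenGap-packing v x y x-near y-near x∈B y∈B = near x-near y-near (∈B x∈B) (∈B y∈B)
    where
    ∈B : ∀ {z} → z ∈ packingSet → InPacking z
    ∈B = ∈-fromDec⁻ inPacking?
    near : InClosedOut D v x → InClosedOut D v y → InPacking x → InPacking y → x ≡ y
    near (inj₁ refl) (inj₁ refl) _  _  = refl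
    near (inj₁ refl) (inj₂ arc)  bx by = contradiction by (no-parent-child (arc⇒parent arc) bx)
    near (inj₂ arc)  (inj₁ refl) bx by = contradiction bx (no-parent-child (arc⇒parent arc) by)
    near (inj₂ arc)  (inj₂ arc′) bx by = siblings-equal (trans (arc⇒parent arc) (sym (arc⇒parent arc′))) bx by

  evenDist⇒support⊎evenGap : ∀ {v} → EvenDist v → Support v ⊎ EvenGap v
  evenDist⇒support⊎evenGap {v} evenDist with support? v
  ... | yes sv = inj₁ sv
  ... | no ¬sv = inj₂ (¬sv , evenDist)

  leafOrSelf-packs : ∀ {v} → Support v ⊎ EvenGap v → InPacking (leafOrSelf v)
  leafOrSelf-packs (inj₁ sv) = let leaf , child = leafOrSelf-support sv in inj₁ (leaf , cong leafOrSelf child)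
  leafOrSelf-packs (inj₂ gv) = inj₂ (subst EvenGap (sym (leafOrSelf-other (proj₁ gv))) gv)

  leafOrSelf-separates : ∀ {x y} → Support x → EvenGap y → leafOrSelf x ≢ leafOrSelf y
  leafOrSelf-separates sx gy same = proj₁ (leafOrSelf-support sx)
    (subst HasChild (sym (trans same (leafOrSelf-other (proj₁ gy)))) (evenGap⇒hasChild gy))

  leafOrSelf-injective : ∀ {x y} → Support x ⊎ EvenGap x → Support y ⊎ EvenGap y
    → leafOrSelf x ≡ leafOrSelf y → x ≡ y
  leafOrSelf-injective (inj₁ sx) (inj₁ sy) same =
    trans (sym (proj₂ (leafOrSelf-support sx))) (trans (cong parent same) (proj₂ (leafOrSelf-support sy)))
  leafOrSelf-injective (inj₁ sx) (inj₂ gy) same = contradiction same (leafOrSelf-separates sx gy)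
  leafOrSelf-injective (inj₂ gx) (inj₁ sy) same = contradiction (sym same) (leafOrSelf-separates sy gx)
  leafOrSelf-injective (inj₂ gx) (inj₂ gy) same =
    trans (sym (leafOrSelf-other (proj₁ gx))) (trans same (leafOrSelf-other (proj₁ gy)))

  ∣dominatingSet∣≤∣packingSet∣ : ∣ dominatingSet ∣ ≤ ∣ packingSet ∣
  ∣dominatingSet∣≤∣packingSet∣ = injective⇒∣p∣≤∣q∣ leafOrSelf
    (∈-fromDec⁺ inPacking? ∘ leafOrSelf-packs ∘ split)
    (λ x∈S y∈S → leafOrSelf-injective (split x∈S) (split y∈S))
    where
    split : ∀ {v} → v ∈ dominatingSet → Support v ⊎ EvenGap v
    split = evenDist⇒support⊎evenGap ∘ ∈-fromDec⁻ evenDist?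

lemma11 : ∀ (m : ℕ) (D : Digraph (suc m))
    → Contrafunctional D → Connected D → HeightIs D 1
    → ∃[ k ] (DominationNumberIs D k × PackingNumberIs D k)
lemma11 m D cf connected height =
  dominating≤packing⇒γ≡ρ D evenDist-dominating designated∪evenGap-packing ∣dominatingSet∣≤∣packingSet∣
  where open HeightOne D cf connected height
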